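{- The number of line complexes on an $8$-point set $P$ that omit no point and contain no isolated tree is $1{,}657{,}845-200{,}970=1{,}456{,}875$.
   Context: $P$ is a set of $8$ points (the points of $\mathbb F_2^3$). A line is a $2$-element subset of $P$; there are $28$ lines. A line complex is a set of exactly $8$ distinct lines. $\mathcal C$ omits $p$ if no line of $\mathcal C$ contains $p$. Viewing $\mathcal C$ as a graph with vertex set $P$ and edge set $\mathcal C$, an isolated tree is a connected component containing at least one line which is a tree. -}

module Defs where

open import Data.Bool using (Bool; true; false; if_then_else_)
open import Data.Nat using (ℕ; zero; suc; _+_; _≤_)
open import Data.Fin using (Fin; _<_)
open import Data.Vec using (Vec; lookup; toList)
open import Data.List using (List; []; _∷_; length; map; _∷ʳ_)
open import Data.Nat.ListAction using (sum)
open import Data.List.Relation.Unary.Unique.Propositional using (Unique)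
open import Data.List.Membership.Propositional using (_∈_)
open import Data.Product using (Σ; ∃; _×_; _,_)
open import Data.Sum using (_⊎_)
open import Data.Unit using (⊤)
open import Data.Empty using (⊥)
open import Relation.Nullary using (¬_)
open import Relation.Binary.PropositionalEquality using (_≡_)
open import Function.Bundles using (_⇔_)

-- The 8 points of P (labelled by Fin 8; the F₂³ structure plays no role).
Point : Set
Point = Fin 8

-- A set of lines (2-element subsets of P) is encoded by an 8×8 Boolean
-- table M; the line {i , j} with i < j belongs to the set iff M[i][j] = true.
-- Entries with ¬ (i < j) are required to be false (see IsLineComplex),
-- so such tables correspond bijectively to sets of lines.
LineTable : Set
LineTable = Vec (Vec Bool 8) 8

entry : LineTable → Point → Point → Bool
entry M i j = lookup (lookup M i) j

Edge : LineTable → Point → Point → Set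
Edge M i j = (i < j × entry M i j ≡ true) ⊎ (j < i × entry M j i ≡ true)

b2n : Bool → ℕ
b2n b = if b then 1 else 0

numLines : LineTable → ℕ
numLines M = sum (map (λ row → sum (map b2n (toList row))) (toList M))

IsLineComplex : LineTable → Set
IsLineComplex M = (∀ i j → entry M i j ≡ true → i < j) × numLines M ≡ 8

Omits : LineTable → Point → Set
Omits M p = ∀ q → ¬ Edge M p q

OmitsNoPoint : LineTable → Set
OmitsNoPoint M = ∀ p → ¬ Omits M p

data Reach (M : LineTable) : Point → Point → Set where
  here : ∀ {i} → Reach M i i
  step : ∀ {i j k} → Edge M i j → Reach M j k → Reach M i k

Path : LineTable → List Point → Set
Path M [] = ⊤
Path M (x ∷ []) = ⊤
Path M (x ∷ y ∷ r) = Edge M x y × Path M (y ∷ r)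

IsCycle : LineTable → List Point → Set
IsCycle M [] = ⊥
IsCycle M (v ∷ vs) = 3 ≤ length (v ∷ vs) × Unique (v ∷ vs) × Path M ((v ∷ vs) ∷ʳ v)

InComp : LineTable → Point → Point → Set
InComp M v u = Reach M v u

CompHasLine : LineTable → Point → Set
CompHasLine M v = Σ Point λ a → Σ Point λ b → InComp M v a × InComp M v b × Edge M a b

-- the component of v (connected by definition) is a tree: it has no cycle
CompIsTree : LineTable → Point → Set
CompIsTree M v = ¬ (Σ (List Point) λ cs → IsCycle M cs × (∀ u → u ∈ cs → InComp M v u))

IsolatedTreeAt : LineTable → Point → Set
IsolatedTreeAt M v = CompHasLine M v × CompIsTree M v

NoIsolatedTree : LineTable → Set
NoIsolatedTree M = ∀ v → ¬ IsolatedTreeAt M v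

Good : LineTable → Set
Good M = IsLineComplex M × OmitsNoPoint M × NoIsolatedTree M

HasExactly : {A : Set} → (A → Set) → ℕ → Set
HasExactly {A} Q n = Σ (List A) λ xs → length xs ≡ n × Unique xs × (∀ a → Q a ⇔ a ∈ xs)

-- A line complex omits no point and has no isolated tree exactly when every connected
-- component of its graph contains a cycle.  All 8-subsets of the 28 lines are examined at once
-- by adding the lines one at a time while maintaining, for every point, a label of its
-- component and a flag recording whether that component contains a cycle: a line between two
-- components merges them (and their flags), a line inside a component creates a cycle
-- through it.  Counting the subsets that end with every flag set is then a dynamic programme
-- over these states in which partial selections reaching the same state are merged, and its
-- value is computed by evaluation.

module Submission where

open import Data.Bool.Base using (Bool; true; false; T; _∨_; if_then_else_)
import Data.Bool.Properties as Bool
open import Data.Bool.Properties using (T?; T-∨)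
open import Data.Empty using (⊥; ⊥-elim)
open import Data.Fin.Base using (Fin; zero; suc; _<_; toℕ)
import Data.Fin.Properties as Fin
open import Data.Fin.Properties using (_≟_; _≤?_; <-asym; <⇒≢; suc-injective)
open import Data.List.Base using (List; []; _∷_; _++_; _∷ʳ_; [_]; length; map; concatMap; foldr; foldl; _ʳ++_)
import Data.List.Properties as List
open import Data.List.Membership.DecPropositional using () renaming (_∈?_ to ∈-dec)
open import Data.List.Membership.Propositional using (_∈_; _∉_)
open import Data.List.Membership.Propositional.Properties
  using (∈-++⁺ˡ; ∈-++⁺ʳ; ∈-++⁻; ∈-∃++; ∈-map⁺; ∈-map⁻)
open import Data.List.Relation.Binary.Permutation.Propositional using (_↭_; ↭-trans; ↭-reflexive; ↭⇒↭ₛ)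
import Data.List.Relation.Binary.Permutation.Propositional.Properties as Permutation
import Data.List.Relation.Binary.Permutation.Setoid.Properties as Permutationₛ
open import Data.List.Relation.Unary.All using (All; []; _∷_)
import Data.List.Relation.Unary.All as All
open import Data.List.Relation.Unary.All.Properties using (¬Any⇒All¬; All¬⇒¬Any)
open import Data.List.Relation.Unary.AllPairs using ([]; _∷_)
open import Data.List.Relation.Unary.Any using (here; there)
open import Data.List.Relation.Unary.Any.Properties using (reverseAcc⁺; reverseAcc⁻)
open import Data.List.Relation.Unary.Linked using (Linked; []; [-]; _∷_)
import Data.List.Relation.Unary.Linked as Linked
open import Data.List.Relation.Unary.Unique.Propositional using (Unique)
import Data.List.Relation.Unary.Unique.Propositional.Properties as Unique
import Data.List.Sort.MergeSort as MergeSort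
import Data.List.Sort.MergeSort.Properties as MergeSort
open import Data.Nat.Base using (ℕ; zero; suc; _+_; _*_; _≤_; s≤s; z≤n)
import Data.Nat.Base as ℕ
import Data.Nat.Properties as ℕ
open import Data.Nat.ListAction using (sum)
open import Data.Nat.ListAction.Properties using (sum-++; sum-↭)
open import Data.Product.Base using (Σ; ∃; _×_; _,_; proj₁; proj₂; uncurry)
import Data.Product.Base as Product
open import Data.Product.Function.NonDependent.Propositional using (_×-⇔_)
open import Data.Sum.Base using (_⊎_; inj₁; inj₂)
import Data.Sum.Base as Sum
open import Data.Sum.Function.Propositional using (_⊎-⇔_)
open import Data.Unit using (tt)
open import Data.Vec.Base using (Vec; []; _∷_; lookup; tabulate; allFin; replicate; take; drop; tail; toList)
open import Data.Vec.Properties using (lookup∘tabulate)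
import Data.Vec.Base as Vec
import Data.Vec.Properties as Vec
open import Data.Vec.Relation.Unary.All using ([]; _∷_)
import Data.Vec.Relation.Unary.All as VecAll
import Data.Vec.Relation.Unary.All.Properties as VecAll
open import Data.Vec.Relation.Unary.AllPairs using ([]; _∷_)
import Data.Vec.Relation.Unary.AllPairs as VecAllPairs
import Data.Vec.Relation.Unary.AllPairs.Properties as VecAllPairs
import Data.Vec.Relation.Unary.Unique.Propositional as VecUnique
open import Function.Base using (_∘_)
open import Function.Bundles using (_⇔_; mk⇔; Equivalence)
import Function.Properties.Equivalence as ⇔
open import Function.Related.Propositional using (module EquationalReasoning; equivalence)
open import Level using (0ℓ)
open import Relation.Binary.Bundles using (DecTotalOrder)
open import Relation.Binary.Core using (Rel; _⇒_)
open import Relation.Binary.Definitions using (Symmetric; DecidableEquality)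
open import Relation.Binary.Construct.Closure.ReflexiveTransitive using (Star; ε; _◅_; _◅◅_)
import Relation.Binary.Construct.Closure.ReflexiveTransitive as Star
import Relation.Binary.Construct.On as On
open import Relation.Binary.PropositionalEquality
  using (_≡_; _≢_; refl; sym; trans; cong; cong₂; subst; setoid; module ≡-Reasoning)
open import Relation.Nullary using (¬_; Dec; does; yes; no; map′; _×-dec_; _⊎-dec_)
open import Defs

T-does : ∀ {P : Set} (P? : Dec P) → T (does P?) ⇔ P
T-does (yes p) = mk⇔ (λ _ → p) _
T-does (no ¬p) = mk⇔ (λ ()) ¬p

-- Graphs given by an adjacency relation

module _ {V : Set} where

  data AddLine (R : Rel V 0ℓ) (a b : V) : Rel V 0ℓ where
    new  : AddLine R a b a b
    new˘ : AddLine R a b b a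
    old  : ∀ {x y} → R x y → AddLine R a b x y

  lastOf : V → List V → V
  lastOf x []       = x
  lastOf x (y ∷ ys) = lastOf y ys

  Cycle : Rel V 0ℓ → List V → Set
  Cycle R []       = ⊥
  Cycle R (v ∷ vs) = 3 ≤ length (v ∷ vs) × Unique (v ∷ vs) × Linked R ((v ∷ vs) ∷ʳ v)

  OnCycle : Rel V 0ℓ → V → Set
  OnCycle R v = ∃ λ vs → Cycle R (v ∷ vs)

  ReachesCycle : Rel V 0ℓ → V → Set
  ReachesCycle R x = ∃ λ w → Star R x w × OnCycle R w

  lastOf-∈ : ∀ x xs → lastOf x xs ∈ (x ∷ xs)
  lastOf-∈ x []       = here refl
  lastOf-∈ x (y ∷ ys) = there (lastOf-∈ y ys)

  lastOf-∷ʳ : ∀ x xs {y} → lastOf x (xs ∷ʳ y) ≡ y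
  lastOf-∷ʳ x []       = refl
  lastOf-∷ʳ x (z ∷ zs) = lastOf-∷ʳ z zs

  module _ {R : Rel V 0ℓ} where

    linked-∷ʳ⁺ : ∀ {x} xs {y} → Linked R (x ∷ xs) → R (lastOf x xs) y → Linked R ((x ∷ xs) ∷ʳ y)
    linked-∷ʳ⁺ []       [-]      r = r ∷ [-]
    linked-∷ʳ⁺ (_ ∷ xs) (e ∷ es) r = e ∷ linked-∷ʳ⁺ xs es r

    linked-∷ʳ⁻ : ∀ {x} xs {y} → Linked R ((x ∷ xs) ∷ʳ y) → Linked R (x ∷ xs) × R (lastOf x xs) y
    linked-∷ʳ⁻ []       (r ∷ [-]) = [-] , r
    linked-∷ʳ⁻ (_ ∷ xs) (e ∷ es)  with linked-∷ʳ⁻ xs es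
    ... | es′ , r = e ∷ es′ , r

    linked⇒star : ∀ {x} xs → Linked R (x ∷ xs) → ∀ {u} → u ∈ (x ∷ xs) → Star R x u
    linked⇒star xs       _        (here refl) = ε
    linked⇒star (_ ∷ xs) (e ∷ es) (there u∈)  = e ◅ linked⇒star xs es u∈

    cycle⇒star : ∀ {v} vs → Cycle R (v ∷ vs) → ∀ {u} → u ∈ (v ∷ vs) → Star R v u
    cycle⇒star vs (_ , _ , walk) u∈ = linked⇒star (vs ∷ʳ _) walk (∈-++⁺ˡ u∈)

    onCycle⇒edge : ∀ {v} → OnCycle R v → ∃ (R v)
    onCycle⇒edge ([]    , _ , _ , e ∷ _) = _ , e
    onCycle⇒edge (_ ∷ _ , _ , _ , e ∷ _) = _ , e

    reachesCycle⇒edge : ∀ {x} → ReachesCycle R x → ∃ (R x)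
    reachesCycle⇒edge (_ , e ◅ _ , _)       = _ , e
    reachesCycle⇒edge (_ , ε     , onCycle) = onCycle⇒edge onCycle

    reachesCycle-◅◅ : ∀ {x y} → Star R x y → ReachesCycle R y → ReachesCycle R x
    reachesCycle-◅◅ x→y (w , y→w , onCycle) = w , x→y ◅◅ y→w , onCycle

    rotate : ∀ x xs → Cycle R (x ∷ xs) → Cycle R (xs ∷ʳ x)
    rotate x []       (s≤s () , _)
    rotate x (y ∷ ys) (long , distinct , e ∷ walk) =
      subst (3 ≤_) (Permutation.↭-length x∷xs↭) long ,
      Permutationₛ.Unique-resp-↭ (setoid V) (↭⇒↭ₛ x∷xs↭) distinct ,
      linked-∷ʳ⁺ (ys ∷ʳ x) walk (subst (λ z → R z y) (sym (lastOf-∷ʳ y ys)) e)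
      where x∷xs↭ = Permutation.∷↭∷ʳ x (y ∷ ys)

    rotate-to : ∀ pre {u} post → Cycle R (pre ++ u ∷ post) → Cycle R (u ∷ post ++ pre)
    rotate-to []        post c = subst (Cycle R) (sym (List.++-identityʳ (_ ∷ post))) c
    rotate-to (p ∷ pre) {u} post c =
      subst (Cycle R) (List.++-assoc (u ∷ post) [ p ] pre)
        (rotate-to pre (post ∷ʳ p) (subst (Cycle R) (List.++-assoc pre (u ∷ post) [ p ]) (rotate p (pre ++ u ∷ post) c)))

    cycle⇒onCycle : ∀ {cs u} → Cycle R cs → u ∈ cs → OnCycle R u
    cycle⇒onCycle c u∈ with ∈-∃++ u∈
    ... | pre , post , refl = _ , rotate-to pre post c

  module _ {R S : Rel V 0ℓ} (R⇒S : R ⇒ S) where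

    cycle-map : ∀ cs → Cycle R cs → Cycle S cs
    cycle-map (v ∷ vs) (long , distinct , walk) = long , distinct , Linked.map R⇒S walk

    reachesCycle-map : ∀ {x} → ReachesCycle R x → ReachesCycle S x
    reachesCycle-map (w , x→w , vs , c) = w , Star.map R⇒S x→w , vs , cycle-map (w ∷ vs) c

  module _ {R : Rel V 0ℓ} where

    star-old : ∀ {a b} → Star R ⇒ Star (AddLine R a b)
    star-old = Star.map old

    Via : V → V → V → V → Set
    Via a b x y = Star R x y ⊎ (Star R x a × Star R b y) ⊎ (Star R x b × Star R a y)

    via-◅ : ∀ {a b x j y} → AddLine R a b x j → Via a b j y → Via a b x y
    via-◅ new     (inj₁ b→y)                = inj₂ (inj₁ (ε , b→y))
    via-◅ new     (inj₂ (inj₁ (_ , b→y)))   = inj₂ (inj₁ (ε , b→y))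
    via-◅ new     (inj₂ (inj₂ (_ , a→y)))   = inj₁ a→y
    via-◅ new˘    (inj₁ a→y)                = inj₂ (inj₂ (ε , a→y))
    via-◅ new˘    (inj₂ (inj₁ (_ , b→y)))   = inj₁ b→y
    via-◅ new˘    (inj₂ (inj₂ (_ , a→y)))   = inj₂ (inj₂ (ε , a→y))
    via-◅ (old e) (inj₁ j→y)                = inj₁ (e ◅ j→y)
    via-◅ (old e) (inj₂ (inj₁ (j→a , b→y))) = inj₂ (inj₁ (e ◅ j→a , b→y))
    via-◅ (old e) (inj₂ (inj₂ (j→b , a→y))) = inj₂ (inj₂ (e ◅ j→b , a→y))

    star-addLine⁻ : ∀ {a b x y} → Star (AddLine R a b) x y → Via a b x y
    star-addLine⁻ ε          = inj₁ ε
    star-addLine⁻ (e ◅ rest) = via-◅ e (star-addLine⁻ rest)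

    star-addLine⁺ : ∀ {a b x y} → Via a b x y → Star (AddLine R a b) x y
    star-addLine⁺ (inj₁ x→y)                = star-old x→y
    star-addLine⁺ (inj₂ (inj₁ (x→a , b→y))) = star-old x→a ◅◅ new ◅ star-old b→y
    star-addLine⁺ (inj₂ (inj₂ (x→b , a→y))) = star-old x→b ◅◅ new˘ ◅ star-old a→y

    star-addLine : Symmetric R → ∀ {a b x y} →
                   Star (AddLine R a b) x y ⇔
                   (Star R x y ⊎ ((Star R x a ⊎ Star R x b) × (Star R y a ⊎ Star R y b)))
    star-addLine sym′ {a} {b} = mk⇔ (to ∘ star-addLine⁻) (star-addLine⁺ ∘ from)
      where
      rev = Star.reverse sym′
      to : ∀ {x y} → Via a b x y → Star R x y ⊎ ((Star R x a ⊎ Star R x b) × (Star R y a ⊎ Star R y b))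
      to (inj₁ x→y)                = inj₁ x→y
      to (inj₂ (inj₁ (x→a , b→y))) = inj₂ (inj₁ x→a , inj₂ (rev b→y))
      to (inj₂ (inj₂ (x→b , a→y))) = inj₂ (inj₂ x→b , inj₁ (rev a→y))
      from : ∀ {x y} → Star R x y ⊎ ((Star R x a ⊎ Star R x b) × (Star R y a ⊎ Star R y b)) → Via a b x y
      from (inj₁ x→y)                   = inj₁ x→y
      from (inj₂ (inj₁ x→a , inj₁ y→a)) = inj₁ (x→a ◅◅ rev y→a)
      from (inj₂ (inj₁ x→a , inj₂ y→b)) = inj₂ (inj₁ (x→a , rev y→b))
      from (inj₂ (inj₂ x→b , inj₁ y→a)) = inj₂ (inj₂ (x→b , rev y→a))
      from (inj₂ (inj₂ x→b , inj₂ y→b)) = inj₁ (x→b ◅◅ rev y→b)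

    star-collapse : ∀ {a b} → Star R a b → Star R b a → Star (AddLine R a b) ⇒ Star R
    star-collapse a→b b→a ε           = ε
    star-collapse a→b b→a (new ◅ p)   = a→b ◅◅ star-collapse a→b b→a p
    star-collapse a→b b→a (new˘ ◅ p)  = b→a ◅◅ star-collapse a→b b→a p
    star-collapse a→b b→a (old e ◅ p) = e ◅ star-collapse a→b b→a p

    linked-avoid : ∀ {a b xs} → a ∉ xs → Linked (AddLine R a b) xs → Linked R xs
    linked-avoid a∉ []           = []
    linked-avoid a∉ [-]          = [-]
    linked-avoid a∉ (new ∷ _)    = ⊥-elim (a∉ (here refl))
    linked-avoid a∉ (new˘ ∷ _)   = ⊥-elim (a∉ (there (here refl)))
    linked-avoid a∉ (old e ∷ es) = e ∷ linked-avoid (a∉ ∘ there) es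

    cycle-avoid : ∀ {a b} cs → a ∉ cs → Cycle (AddLine R a b) cs → Cycle R cs
    cycle-avoid (v ∷ vs) a∉ (long , distinct , walk) = long , distinct , linked-avoid a∉walk walk
      where
      a∉walk : _ ∉ (v ∷ vs) ∷ʳ v
      a∉walk a∈ with ∈-++⁻ (v ∷ vs) a∈
      ... | inj₁ a∈cs        = a∉ a∈cs
      ... | inj₂ (here refl) = a∉ (here refl)

    addLine-leaving : ∀ {a b w} → a ≢ b → AddLine R a b a w → w ≡ b ⊎ R a w
    addLine-leaving _   new     = inj₁ refl
    addLine-leaving a≢b new˘    = ⊥-elim (a≢b refl)
    addLine-leaving _   (old e) = inj₂ e

    addLine-entering : ∀ {a b z} → a ≢ b → AddLine R a b z a → z ≡ b ⊎ R z a
    addLine-entering a≢b new     = ⊥-elim (a≢b refl)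
    addLine-entering _   new˘    = inj₁ refl
    addLine-entering _   (old e) = inj₂ e

    -- A cycle through a either avoids the new line, or the rest of it joins b to a in R.
    onCycle-addLine : Symmetric R → ∀ {a b} → a ≢ b → OnCycle (AddLine R a b) a → OnCycle R a ⊎ Star R a b
    onCycle-addLine _ _ ([]     , s≤s () , _)
    onCycle-addLine _ _ (_ ∷ [] , s≤s (s≤s ()) , _)
    onCycle-addLine sym′ a≢b (w ∷ v ∷ vs , long , distinct@(a∉ ∷ w∉ ∷ _) , first ∷ walk)
      with linked-∷ʳ⁻ (v ∷ vs) walk
    ... | path , final
      with linked-avoid (All¬⇒¬Any a∉) path | addLine-leaving a≢b first | addLine-entering a≢b final
    ...   | path′ | inj₂ e    | inj₂ e′   = inj₁ (w ∷ v ∷ vs , long , distinct , e ∷ linked-∷ʳ⁺ (v ∷ vs) path′ e′)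
    ...   | path′ | inj₁ refl | inj₂ e′   =
      inj₂ (Star.reverse sym′ (linked⇒star (v ∷ vs) path′ (lastOf-∈ w (v ∷ vs)) ◅◅ e′ ◅ ε))
    ...   | path′ | inj₂ e    | inj₁ refl = inj₂ (e ◅ linked⇒star (v ∷ vs) path′ (lastOf-∈ w (v ∷ vs)))
    ...   | _     | inj₁ w≡b  | inj₁ z≡b  = ⊥-elim (All.lookup w∉ (lastOf-∈ v vs) (trans w≡b (sym z≡b)))

  module _ (_≟ᵛ_ : DecidableEquality V) {R : Rel V 0ℓ} where

    SimpleWalk : V → V → Set
    SimpleWalk x y = ∃ λ us → Unique (x ∷ us) × Linked R (x ∷ us) × lastOf x us ≡ y

    suffixFrom : ∀ {x} w ws → x ∈ (w ∷ ws) → Unique (w ∷ ws) → Linked R (w ∷ ws) → SimpleWalk x (lastOf w ws)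
    suffixFrom w ws       (here refl) distinct       walk       = ws , distinct , walk , refl
    suffixFrom w (v ∷ vs) (there x∈)  (_ ∷ distinct) (_ ∷ walk) = suffixFrom v vs x∈ distinct walk

    simpleWalk : ∀ {x y} → Star R x y → SimpleWalk x y
    simpleWalk ε = [] , [] ∷ [] , [-] , refl
    simpleWalk {x} (_◅_ {j = j} e rest) with simpleWalk rest
    ... | us , distinct , walk , end with ∈-dec _≟ᵛ_ x (j ∷ us)
    ...   | yes x∈ = let vs , distinct′ , walk′ , end′ = suffixFrom j us x∈ distinct walk
                     in vs , distinct′ , walk′ , trans end′ end
    ...   | no x∉  = j ∷ us , ¬Any⇒All¬ (j ∷ us) x∉ ∷ distinct , e ∷ walk , end

    closeCycle : ∀ {a b} → Star R a b → ¬ R a b → a ≢ b → OnCycle (AddLine R a b) a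
    closeCycle a→b ¬ab a≢b with simpleWalk a→b
    ... | []             , _        , _       , refl = ⊥-elim (a≢b refl)
    ... | _ ∷ []         , _        , e ∷ [-] , refl = ⊥-elim (¬ab e)
    ... | us@(_ ∷ _ ∷ _) , distinct , walk    , end  =
      us , s≤s (s≤s (s≤s z≤n)) , distinct ,
      linked-∷ʳ⁺ us (Linked.map old walk) (subst (λ z → AddLine R _ _ z _) (sym end) new˘)

    reachesCycle-close : Symmetric R → ∀ {a b x} → Star R a b → ¬ R a b → a ≢ b →
                         ReachesCycle (AddLine R a b) x ⇔ (ReachesCycle R x ⊎ Star R x a)
    reachesCycle-close sym′ {a} {b} a→b ¬ab a≢b = mk⇔ to from
      where
      collapse : Star (AddLine R a b) ⇒ Star R
      collapse = star-collapse a→b (Star.reverse sym′ a→b)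
      to : ∀ {x} → ReachesCycle (AddLine R a b) x → ReachesCycle R x ⊎ Star R x a
      to (w , x→w , vs , c) with ∈-dec _≟ᵛ_ a (w ∷ vs)
      ... | yes a∈ = inj₂ (collapse (x→w ◅◅ cycle⇒star vs c a∈))
      ... | no a∉  = inj₁ (w , collapse x→w , vs , cycle-avoid (w ∷ vs) a∉ c)
      from : ∀ {x} → ReachesCycle R x ⊎ Star R x a → ReachesCycle (AddLine R a b) x
      from (inj₁ rc)  = reachesCycle-map old rc
      from (inj₂ x→a) = a , star-old x→a , closeCycle a→b ¬ab a≢b

    reachesCycle-join : Symmetric R → ∀ {a b x} → ¬ Star R a b →
                        ReachesCycle (AddLine R a b) x ⇔
                        (ReachesCycle R x ⊎ ((Star R x a ⊎ Star R x b) × (ReachesCycle R a ⊎ ReachesCycle R b)))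
    reachesCycle-join sym′ {a} {b} ¬a→b = mk⇔ to from
      where
      a≢b : a ≢ b
      a≢b refl = ¬a→b ε
      onOldCycle : ∀ {x} → ReachesCycle (AddLine R a b) x → ∃ λ w → Star (AddLine R a b) x w × OnCycle R w
      onOldCycle (w , x→w , vs , c) with ∈-dec _≟ᵛ_ a (w ∷ vs)
      ... | no a∉  = w , x→w , vs , cycle-avoid (w ∷ vs) a∉ c
      ... | yes a∈ with onCycle-addLine sym′ a≢b (cycle⇒onCycle c a∈)
      ...   | inj₁ onCycle = a , x→w ◅◅ cycle⇒star vs c a∈ , onCycle
      ...   | inj₂ a→b     = ⊥-elim (¬a→b a→b)
      to : ∀ {x} → ReachesCycle (AddLine R a b) x →
           ReachesCycle R x ⊎ ((Star R x a ⊎ Star R x b) × (ReachesCycle R a ⊎ ReachesCycle R b))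
      to rc with onOldCycle rc
      ... | w , x→w , onCycle with star-addLine⁻ x→w
      ...   | inj₁ x→w′               = inj₁ (w , x→w′ , onCycle)
      ...   | inj₂ (inj₁ (x→a , b→w)) = inj₂ (inj₁ x→a , inj₂ (w , b→w , onCycle))
      ...   | inj₂ (inj₂ (x→b , a→w)) = inj₂ (inj₂ x→b , inj₁ (w , a→w , onCycle))
      from : ∀ {x} → ReachesCycle R x ⊎ ((Star R x a ⊎ Star R x b) × (ReachesCycle R a ⊎ ReachesCycle R b)) →
             ReachesCycle (AddLine R a b) x
      from (inj₁ rc)                   = reachesCycle-map old rc
      from (inj₂ (inj₁ x→a , inj₁ rc)) = reachesCycle-◅◅ (star-old x→a) (reachesCycle-map old rc)
      from (inj₂ (inj₁ x→a , inj₂ rc)) = reachesCycle-◅◅ (star-old x→a ◅◅ new ◅ ε) (reachesCycle-map old rc)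
      from (inj₂ (inj₂ x→b , inj₁ rc)) = reachesCycle-◅◅ (star-old x→b ◅◅ new˘ ◅ ε) (reachesCycle-map old rc)
      from (inj₂ (inj₂ x→b , inj₂ rc)) = reachesCycle-◅◅ (star-old x→b) (reachesCycle-map old rc)

-- Components with cycle flags

record Components (n : ℕ) : Set where
  constructor components
  field
    labels : Vec (Fin n) n
    cyclic : Vec Bool n
open Components

module _ {n : ℕ} where

  label : Components n → Fin n → Fin n
  label c = lookup (labels c)

  flag : Components n → Fin n → Bool
  flag c = lookup (cyclic c)

  discrete : Components n
  discrete = components (allFin n) (replicate n false)

  closeAt : Components n → Fin n → Components n
  closeAt c a = components (labels c) (tabulate λ x → flag c x ∨ does (label c x ≟ label c a))

  -- Merged components keep the smaller label, so every component is labelled by its least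
  -- point and equal partitions give equal states.
  lesser : Fin n → Fin n → Fin n
  lesser i j = if does (i ≤? j) then i else j

  lesser-∈ : ∀ i j → lesser i j ≡ i ⊎ lesser i j ≡ j
  lesser-∈ i j with does (i ≤? j)
  ... | true  = inj₁ refl
  ... | false = inj₂ refl

  touches : Components n → Fin n → Fin n → Fin n → Bool
  touches c a b x = does (label c x ≟ label c a) ∨ does (label c x ≟ label c b)

  join : Components n → Fin n → Fin n → Components n
  join c a b = components
    (tabulate λ x → if touches c a b x then lesser (label c a) (label c b) else label c x)
    (tabulate λ x → if touches c a b x then flag c a ∨ flag c b else flag c x)

  addLine : Components n → Fin n × Fin n → Components n
  addLine c (a , b) = if does (label c a ≟ label c b) then closeAt c a else join c a b

  record Tracks (R : Rel (Fin n) 0ℓ) (c : Components n) : Set where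
    field
      label-≡ : ∀ {x y} → label c x ≡ label c y ⇔ Star R x y
      flag-T  : ∀ {x} → T (flag c x) ⇔ ReachesCycle R x

  module _ {R : Rel (Fin n) 0ℓ} {c : Components n} (sym′ : Symmetric R) (tracks : Tracks R c) where
    open Tracks tracks
    open EquationalReasoning {k = equivalence}

    closeAt-tracks : ∀ {a b} → Star R a b → ¬ R a b → a ≢ b → Tracks (AddLine R a b) (closeAt c a)
    closeAt-tracks {a} {b} a→b ¬ab a≢b = record
      { label-≡ = ⇔.trans label-≡ (mk⇔ star-old (star-collapse a→b (Star.reverse sym′ a→b)))
      ; flag-T  = λ {x} → begin
          T (flag (closeAt c a) x)                            ≡⟨ cong T (lookup∘tabulate _ x) ⟩
          T (flag c x ∨ does (label c x ≟ label c a))         ∼⟨ T-∨ ⟩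
          (T (flag c x) ⊎ T (does (label c x ≟ label c a)))   ∼⟨ flag-T ⊎-⇔ ⇔.trans (T-does (label c x ≟ label c a)) label-≡ ⟩
          (ReachesCycle R x ⊎ Star R x a)                     ∼⟨ ⇔.sym (reachesCycle-close _≟_ sym′ a→b ¬ab a≢b) ⟩
          ReachesCycle (AddLine R a b) x                      ∎
      }

    module _ {a b : Fin n} where

      T-touches : ∀ {x} → T (touches c a b x) ⇔ (Star R x a ⊎ Star R x b)
      T-touches {x} =
        ⇔.trans T-∨ (⇔.trans (T-does (label c x ≟ label c a)) label-≡ ⊎-⇔
                     ⇔.trans (T-does (label c x ≟ label c b)) label-≡)

      touches-cong : ∀ {x y} → label c x ≡ label c y → touches c a b x ≡ touches c a b y
      touches-cong = cong (λ l → does (l ≟ label c a) ∨ does (l ≟ label c b))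

      untouched-≢-lesser : ∀ {y} → touches c a b y ≡ false → label c y ≢ lesser (label c a) (label c b)
      untouched-≢-lesser {y} untouched y≡lesser =
        subst T untouched (Equivalence.from T-∨ (Sum.map (fromWitness (label c y ≟ label c a)) (fromWitness (label c y ≟ label c b))
          (Sum.map (trans y≡lesser) (trans y≡lesser) (lesser-∈ (label c a) (label c b)))))
        where
        fromWitness : ∀ {P : Set} (P? : Dec P) → P → T (does P?)
        fromWitness P? = Equivalence.from (T-does P?)

      relabel-≡ : ∀ {x y} →
        ((if touches c a b x then lesser (label c a) (label c b) else label c x) ≡
         (if touches c a b y then lesser (label c a) (label c b) else label c y)) ⇔
        (label c x ≡ label c y ⊎ (T (touches c a b x) × T (touches c a b y)))
      relabel-≡ {x} {y} with touches c a b x in tx | touches c a b y in ty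
      ... | true  | true  = mk⇔ (λ _ → inj₂ (_ , _)) (λ _ → refl)
      ... | false | false = mk⇔ inj₁ from
        where
        from : label c x ≡ label c y ⊎ (⊥ × ⊥) → label c x ≡ label c y
        from (inj₁ x≡y) = x≡y
      ... | true  | false = mk⇔ (⊥-elim ∘ untouched-≢-lesser ty ∘ sym) from
        where
        from : label c x ≡ label c y ⊎ (T true × ⊥) → lesser (label c a) (label c b) ≡ label c y
        from (inj₁ x≡y) with () ← trans (sym tx) (trans (touches-cong x≡y) ty)
      ... | false | true  = mk⇔ (⊥-elim ∘ untouched-≢-lesser tx) from
        where
        from : label c x ≡ label c y ⊎ (⊥ × T true) → label c x ≡ lesser (label c a) (label c b)
        from (inj₁ x≡y) with () ← trans (sym ty) (trans (touches-cong (sym x≡y)) tx)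

      reflag : ∀ {x} →
        T (if touches c a b x then flag c a ∨ flag c b else flag c x) ⇔
        (ReachesCycle R x ⊎ (T (touches c a b x) × (ReachesCycle R a ⊎ ReachesCycle R b)))
      reflag {x} with touches c a b x in tx
      ... | true  = mk⇔ (λ h → inj₂ (_ , Equivalence.to flags⇔ h)) from
        where
        flags⇔ : T (flag c a ∨ flag c b) ⇔ (ReachesCycle R a ⊎ ReachesCycle R b)
        flags⇔ = ⇔.trans T-∨ (flag-T ⊎-⇔ flag-T)
        from : ReachesCycle R x ⊎ (T true × (ReachesCycle R a ⊎ ReachesCycle R b)) → T (flag c a ∨ flag c b)
        from (inj₂ (_ , rc)) = Equivalence.from flags⇔ rc
        from (inj₁ rc)       = Equivalence.from flags⇔
          (Sum.map (λ x→a → reachesCycle-◅◅ (Star.reverse sym′ x→a) rc)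
                   (λ x→b → reachesCycle-◅◅ (Star.reverse sym′ x→b) rc)
                   (Equivalence.to T-touches (subst T (sym tx) _)))
      ... | false = mk⇔ (inj₁ ∘ Equivalence.to flag-T) from
        where
        from : ReachesCycle R x ⊎ (⊥ × (ReachesCycle R a ⊎ ReachesCycle R b)) → T (flag c x)
        from (inj₁ rc) = Equivalence.from flag-T rc

      join-tracks : ¬ Star R a b → Tracks (AddLine R a b) (join c a b)
      join-tracks ¬a→b = record
        { label-≡ = λ {x} {y} → begin
            (label (join c a b) x ≡ label (join c a b) y)    ≡⟨ cong₂ _≡_ (lookup∘tabulate _ x) (lookup∘tabulate _ y) ⟩
            _                                                ∼⟨ relabel-≡ ⟩
            (label c x ≡ label c y ⊎ (T (touches c a b x) × T (touches c a b y)))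
                                                             ∼⟨ label-≡ ⊎-⇔ T-touches ×-⇔ T-touches ⟩
            (Star R x y ⊎ ((Star R x a ⊎ Star R x b) × (Star R y a ⊎ Star R y b)))
                                                             ∼⟨ ⇔.sym (star-addLine sym′) ⟩
            Star (AddLine R a b) x y                         ∎
        ; flag-T = λ {x} → begin
            T (flag (join c a b) x)                          ≡⟨ cong T (lookup∘tabulate _ x) ⟩
            _                                                ∼⟨ reflag ⟩
            (ReachesCycle R x ⊎ (T (touches c a b x) × (ReachesCycle R a ⊎ ReachesCycle R b)))
                                                             ∼⟨ ⇔.refl ⊎-⇔ T-touches ×-⇔ ⇔.refl ⟩
            (ReachesCycle R x ⊎ ((Star R x a ⊎ Star R x b) × (ReachesCycle R a ⊎ ReachesCycle R b)))
                                                             ∼⟨ ⇔.sym (reachesCycle-join _≟_ sym′ ¬a→b) ⟩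
            ReachesCycle (AddLine R a b) x                   ∎
        }

    addLine-tracks : ∀ {a b} → a ≢ b → ¬ R a b → Tracks (AddLine R a b) (addLine c (a , b))
    addLine-tracks {a} {b} a≢b ¬ab with label c a ≟ label c b
    ... | yes la≡lb = closeAt-tracks (Equivalence.to label-≡ la≡lb) ¬ab a≢b
    ... | no la≢lb  = join-tracks (la≢lb ∘ Equivalence.from label-≡)

-- Adding a sequence of lines

chosen : ∀ {A : Set} {m} → Vec A m → Vec Bool m → List A
chosen []       []           = []
chosen (x ∷ xs) (true ∷ bs)  = x ∷ chosen xs bs
chosen (x ∷ xs) (false ∷ bs) = chosen xs bs

module _ {V : Set} where

  graphOf : List (V × V) → Rel V 0ℓ
  graphOf []             _ _ = ⊥
  graphOf ((a , b) ∷ ls)     = AddLine (graphOf ls) a b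

  graphOf-sym : ∀ ls → Symmetric (graphOf ls)
  graphOf-sym ((a , b) ∷ ls) new     = new˘
  graphOf-sym ((a , b) ∷ ls) new˘    = new
  graphOf-sym ((a , b) ∷ ls) (old e) = old (graphOf-sym ls e)

  graphOf-∈ : ∀ ls {x y} → graphOf ls x y ⇔ ((x , y) ∈ ls ⊎ (y , x) ∈ ls)
  graphOf-∈ ls = mk⇔ (to ls) (from ls)
    where
    to : ∀ ls {x y} → graphOf ls x y → (x , y) ∈ ls ⊎ (y , x) ∈ ls
    to ((a , b) ∷ ls) new     = inj₁ (here refl)
    to ((a , b) ∷ ls) new˘    = inj₂ (here refl)
    to ((a , b) ∷ ls) (old e) = Sum.map there there (to ls e)
    from : ∀ ls {x y} → (x , y) ∈ ls ⊎ (y , x) ∈ ls → graphOf ls x y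
    from ((a , b) ∷ ls) (inj₁ (here refl))  = new
    from ((a , b) ∷ ls) (inj₂ (here refl))  = new˘
    from ((a , b) ∷ ls) (inj₁ (there xy∈)) = old (from ls (inj₁ xy∈))
    from ((a , b) ∷ ls) (inj₂ (there yx∈)) = old (from ls (inj₂ yx∈))

  reverse-∈ : ∀ ls {l : V × V} → l ∈ (ls ʳ++ []) ⇔ l ∈ ls
  reverse-∈ ls = mk⇔ (Sum.[ (λ ()) , (λ l∈ → l∈) ] ∘ reverseAcc⁻ [] ls) (reverseAcc⁺ [] ls ∘ inj₂)

module _ {n : ℕ} where

  run : ∀ {m} → Vec (Fin n × Fin n) m → Vec Bool m → Components n → Components n
  run es bs c = foldl addLine c (chosen es bs)

  Increasing : Fin n × Fin n → Set
  Increasing (a , b) = a < b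

  tracks-resp-⇔ : ∀ {R S : Rel (Fin n) 0ℓ} {c} → (∀ {x y} → R x y ⇔ S x y) → Tracks R c → Tracks S c
  tracks-resp-⇔ R⇔S tracks = record
    { label-≡ = ⇔.trans label-≡ (mk⇔ (Star.map (Equivalence.to R⇔S)) (Star.map (Equivalence.from R⇔S)))
    ; flag-T  = ⇔.trans flag-T (mk⇔ (reachesCycle-map (Equivalence.to R⇔S)) (reachesCycle-map (Equivalence.from R⇔S)))
    }
    where open Tracks tracks

  discrete-tracks : Tracks (graphOf []) (discrete {n})
  discrete-tracks = record
    { label-≡ = λ {x} {y} → mk⇔ (sameLabel (Vec.lookup-allFin x) (Vec.lookup-allFin y)) ε⇒sameLabel
    ; flag-T  = λ {x} → mk⇔ (λ t → ⊥-elim (subst T (Vec.lookup-replicate x false) t)) noCycle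
    }
    where
    sameLabel : ∀ {x y i j} → i ≡ x → j ≡ y → i ≡ j → Star (graphOf []) x y
    sameLabel refl refl refl = ε
    ε⇒sameLabel : ∀ {x y} → Star (graphOf []) x y → lookup (allFin n) x ≡ lookup (allFin n) y
    ε⇒sameLabel ε = refl
    noCycle : ∀ {x} → ReachesCycle (graphOf []) x → T (flag discrete x)
    noCycle rc with () ← proj₂ (reachesCycle⇒edge rc)

  not-in-graphOf : ∀ {acc a b} → (a , b) ∉ acc → All Increasing acc → a < b → ¬ graphOf acc a b
  not-in-graphOf {acc} ab∉ increasing a<b ab with Equivalence.to (graphOf-∈ acc) ab
  ... | inj₁ ab∈ = ab∉ ab∈
  ... | inj₂ ba∈ = <-asym a<b (All.lookup increasing ba∈)

  run-tracks : ∀ {m} (es : Vec (Fin n × Fin n) m) bs {acc c} →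
               VecAll.All Increasing es → VecUnique.Unique es → VecAll.All (_∉ acc) es → All Increasing acc →
               Tracks (graphOf acc) c → Tracks (graphOf (chosen es bs ʳ++ acc)) (run es bs c)
  run-tracks []       []           _                _             _               _    tracks = tracks
  run-tracks (e ∷ es) (false ∷ bs) (_ ∷ increasing) (_ ∷ distinct) (_ ∷ unused)     acc↑ tracks =
    run-tracks es bs increasing distinct unused acc↑ tracks
  run-tracks (e@(a , b) ∷ es) (true ∷ bs) {acc} (a<b ∷ increasing) (e∉es ∷ distinct) (e∉acc ∷ unused) acc↑ tracks =
    run-tracks es bs increasing distinct (VecAll.map (uncurry stillUnused) (VecAll.zip (e∉es , unused))) (a<b ∷ acc↑)
      (addLine-tracks (graphOf-sym acc) tracks (<⇒≢ a<b) (not-in-graphOf e∉acc acc↑ a<b))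
    where
    stillUnused : ∀ {l} → e ≢ l → l ∉ acc → l ∉ (e ∷ acc)
    stillUnused e≢l l∉ (here refl) = e≢l refl
    stillUnused e≢l l∉ (there l∈)  = l∉ l∈

-- Counting the selections that leave every component cyclic

ones : ∀ {m} → Vec Bool m → ℕ
ones v = sum (map b2n (toList v))

module _ {n : ℕ} where

  allCyclic : Components n → Bool
  allCyclic c = does (Fin.all? (λ x → T? (flag c x)))

  T-allCyclic : ∀ c → T (allCyclic c) ⇔ (∀ x → T (flag c x))
  T-allCyclic c = T-does (Fin.all? (λ x → T? (flag c x)))

  accepted : ∀ {m} → Vec (Fin n × Fin n) m → ℕ → Components n → List (Vec Bool m)
  accepted []       zero    c = if allCyclic c then [ [] ] else []
  accepted []       (suc k) c = []
  accepted (e ∷ es) zero    c = map (false ∷_) (accepted es zero c)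
  accepted (e ∷ es) (suc k) c =
    map (false ∷_) (accepted es (suc k) c) ++ map (true ∷_) (accepted es k (addLine c e))

  private
    ∷∈map∷⁻ : ∀ {m b b′} {bs : Vec Bool m} {L} → (b ∷ bs) ∈ map (b′ ∷_) L → b ≡ b′ × bs ∈ L
    ∷∈map∷⁻ {b′ = b′} b∷bs∈ with ∈-map⁻ (b′ ∷_) b∷bs∈
    ... | _ , bs∈ , refl = refl , bs∈

    true∉map-false : ∀ {m} {bs : Vec Bool m} {L} → (true ∷ bs) ∈ map (false ∷_) L → ⊥
    true∉map-false t∈ with () ← proj₁ (∷∈map∷⁻ t∈)

  ∈-accepted : ∀ {m} (es : Vec (Fin n × Fin n) m) {k c} bs →
               bs ∈ accepted es k c ⇔ (ones bs ≡ k × T (allCyclic (run es bs c)))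
  ∈-accepted []       {zero}  {c} [] with allCyclic c
  ... | true  = mk⇔ (λ _ → refl , _) (λ _ → here refl)
  ... | false = mk⇔ (λ ()) (⊥-elim ∘ proj₂)
  ∈-accepted []       {suc k} []           = mk⇔ (λ ()) (λ ())
  ∈-accepted (e ∷ es) {zero}  (false ∷ bs) = ⇔.trans (mk⇔ (proj₂ ∘ ∷∈map∷⁻) (∈-map⁺ (false ∷_))) (∈-accepted es bs)
  ∈-accepted (e ∷ es) {zero}  (true ∷ bs)  = mk⇔ (⊥-elim ∘ true∉map-false) (λ ())
  ∈-accepted (e ∷ es) {suc k} {c} (false ∷ bs) = ⇔.trans (mk⇔ to (∈-++⁺ˡ ∘ ∈-map⁺ (false ∷_))) (∈-accepted es bs)
    where
    to : (false ∷ bs) ∈ accepted (e ∷ es) (suc k) c → bs ∈ accepted es (suc k) c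
    to ∈L with ∈-++⁻ (map (false ∷_) (accepted es (suc k) c)) ∈L
    ... | inj₁ ∈skip = proj₂ (∷∈map∷⁻ ∈skip)
    ... | inj₂ ∈take with () ← proj₁ (∷∈map∷⁻ ∈take)
  ∈-accepted (e ∷ es) {suc k} {c} (true ∷ bs) =
    ⇔.trans (mk⇔ to (∈-++⁺ʳ _ ∘ ∈-map⁺ (true ∷_))) (⇔.trans (∈-accepted es bs) (suc-cong ×-⇔ ⇔.refl))
    where
    to : (true ∷ bs) ∈ accepted (e ∷ es) (suc k) c → bs ∈ accepted es k (addLine c e)
    to ∈L with ∈-++⁻ (map (false ∷_) (accepted es (suc k) c)) ∈L
    ... | inj₁ ∈skip = ⊥-elim (true∉map-false ∈skip)
    ... | inj₂ ∈take = proj₂ (∷∈map∷⁻ ∈take)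
    suc-cong : ones bs ≡ k ⇔ suc (ones bs) ≡ suc k
    suc-cong = mk⇔ (cong suc) ℕ.suc-injective

  accepted-unique : ∀ {m} (es : Vec (Fin n × Fin n) m) k c → Unique (accepted es k c)
  accepted-unique []       zero    c with allCyclic c
  ... | true  = [] ∷ []
  ... | false = []
  accepted-unique []       (suc k) c = []
  accepted-unique (e ∷ es) zero    c = Unique.map⁺ Vec.∷-injectiveʳ (accepted-unique es zero c)
  accepted-unique (e ∷ es) (suc k) c =
    Unique.++⁺ (Unique.map⁺ Vec.∷-injectiveʳ (accepted-unique es (suc k) c))
               (Unique.map⁺ Vec.∷-injectiveʳ (accepted-unique es k (addLine c e)))
               disjoint
    where
    disjoint : ∀ {bs} → ¬ (bs ∈ map (false ∷_) (accepted es (suc k) c) × bs ∈ map (true ∷_) (accepted es k (addLine c e)))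
    disjoint (f∈ , t∈) with ∈-map⁻ (false ∷_) f∈ | ∈-map⁻ (true ∷_) t∈
    ... | _ , _ , refl | _ , _ , ()

  accepted-tooMany : ∀ {m} (es : Vec (Fin n × Fin n) m) {k} c → m ℕ.< k → accepted es k c ≡ []
  accepted-tooMany []       {suc k} c _ = refl
  accepted-tooMany (e ∷ es) {suc k} c (s≤s m<k)
    rewrite accepted-tooMany es c (ℕ.m<n⇒m<1+n m<k) | accepted-tooMany es (addLine c e) m<k = refl

  length-accepted-zero : ∀ {m} e (es : Vec (Fin n × Fin n) m) c →
                         length (accepted (e ∷ es) zero c) ≡ length (accepted es zero c)
  length-accepted-zero e es c = List.length-map (false ∷_) (accepted es zero c)

  length-accepted-suc : ∀ {m} e (es : Vec (Fin n × Fin n) m) k c →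
                        length (accepted (e ∷ es) (suc k) c) ≡
                        length (accepted es (suc k) c) + length (accepted es k (addLine c e))
  length-accepted-suc e es k c =
    trans (List.length-++ (map (false ∷_) (accepted es (suc k) c)))
          (cong₂ _+_ (List.length-map (false ∷_) (accepted es (suc k) c))
                     (List.length-map (true ∷_) (accepted es k (addLine c e))))

module _ {n : ℕ} where

  _≟ᶜ_ : DecidableEquality (Components n)
  components l f ≟ᶜ components l′ f′ =
    map′ (λ (l≡ , f≡) → cong₂ components l≡ f≡) (λ { refl → refl , refl })
         (Vec.≡-dec _≟_ l l′ ×-dec Vec.≡-dec Bool._≟_ f f′)

  -- weight many selections among the lines processed so far lead to state, and each still
  -- needs remaining more lines.
  record Tally : Set where
    constructor tally
    field
      state     : Components n
      remaining : ℕ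
      weight    : ℕ
  open Tally

  value : ∀ {m} → Vec (Fin n × Fin n) m → Tally → ℕ
  value es t = weight t * length (accepted es (remaining t) (state t))

  total : ∀ {m} → Vec (Fin n × Fin n) m → List Tally → ℕ
  total es ts = sum (map (value es) ts)

  total-++ : ∀ {m} (es : Vec (Fin n × Fin n) m) ts us → total es (ts ++ us) ≡ total es ts + total es us
  total-++ es ts us = trans (cong sum (List.map-++ (value es) ts us)) (sum-++ (map (value es) ts) (map (value es) us))

  total-[_] : ∀ {m} (es : Vec (Fin n × Fin n) m) t → total es [ t ] ≡ value es t
  total-[ es ] t = ℕ.+-identityʳ (value es t)

  -- Skip or take the line e, which is followed by m further lines; skipping is dropped once
  -- fewer than the remaining number of lines are left.
  advance : Fin n × Fin n → ℕ → Tally → List Tally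
  advance e m (tally c zero    w) = [ tally c zero w ]
  advance e m (tally c (suc k) w) =
    (if does (suc k ℕ.≤? m) then [ tally c (suc k) w ] else []) ++ [ tally (addLine c e) k w ]

  value-advance : ∀ {m} e (es : Vec (Fin n × Fin n) m) t → value (e ∷ es) t ≡ total es (advance e m t)
  value-advance e es (tally c zero w) =
    trans (cong (w *_) (length-accepted-zero e es c)) (sym (total-[ es ] (tally c zero w)))
  value-advance {m} e es (tally c (suc k) w) = begin
    w * length (accepted (e ∷ es) (suc k) c)
      ≡⟨ cong (w *_) (length-accepted-suc e es k c) ⟩
    w * (length (accepted es (suc k) c) + length (accepted es k c′))
      ≡⟨ ℕ.*-distribˡ-+ w _ _ ⟩
    w * length (accepted es (suc k) c) + w * length (accepted es k c′)
      ≡⟨ cong₂ _+_ (skip (suc k ℕ.≤? m)) (sym (total-[ es ] (tally c′ k w))) ⟩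
    total es skipped + total es [ tally c′ k w ]
      ≡⟨ sym (total-++ es skipped _) ⟩
    total es (advance e m (tally c (suc k) w))
      ∎
    where
    open ≡-Reasoning
    c′ = addLine c e
    skipped : List Tally
    skipped = if does (suc k ℕ.≤? m) then [ tally c (suc k) w ] else []
    skip : (k≤?m : Dec (suc k ≤ m)) →
           w * length (accepted es (suc k) c) ≡ total es (if does k≤?m then [ tally c (suc k) w ] else [])
    skip (yes _)  = sym (total-[ es ] (tally c (suc k) w))
    skip (no k≰m) = trans (cong (λ L → w * length L) (accepted-tooMany es c (ℕ.≰⇒> k≰m))) (ℕ.*-zeroʳ w)

  total-advance : ∀ {m} e (es : Vec (Fin n × Fin n) m) ts → total (e ∷ es) ts ≡ total es (concatMap (advance e m) ts)
  total-advance e es []       = refl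
  total-advance {m} e es (t ∷ ts) =
    trans (cong₂ _+_ (value-advance e es t) (total-advance e es ts)) (sym (total-++ es (advance e m t) _))

  sameClass? : (t u : Tally) → Dec (state t ≡ state u × remaining t ≡ remaining u)
  sameClass? t u = state t ≟ᶜ state u ×-dec remaining t ℕ.≟ remaining u

  -- Branching on does rather than matching yes/no keeps evaluation from building the equality proofs.
  collect : Tally → List Tally → List Tally
  collect t []       = [ t ]
  collect t (u ∷ us) =
    if does (sameClass? t u) then collect (tally (state t) (remaining t) (weight t + weight u)) us else t ∷ collect u us

  total-collect : ∀ {m} (es : Vec (Fin n × Fin n) m) t us → total es (collect t us) ≡ value es t + total es us
  total-collect es t [] = refl
  total-collect es t@(tally c k w) (u@(tally c′ k′ w′) ∷ us) = mergeOrKeep (sameClass? t u)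
    where
    open ≡-Reasoning
    #accepted = length (accepted es k c)
    mergeOrKeep : (same? : Dec (c ≡ c′ × k ≡ k′)) →
                  total es (if does same? then collect (tally c k (w + w′)) us else t ∷ collect u us) ≡
                  value es t + total es (u ∷ us)
    mergeOrKeep (no _) = cong (value es t +_) (total-collect es u us)
    mergeOrKeep (yes (c≡c′ , k≡k′)) = begin
      total es (collect (tally c k (w + w′)) us)          ≡⟨ total-collect es (tally c k (w + w′)) us ⟩
      (w + w′) * #accepted + total es us                  ≡⟨ cong (_+ total es us) (ℕ.*-distribʳ-+ #accepted w w′) ⟩
      (w * #accepted + w′ * #accepted) + total es us      ≡⟨ ℕ.+-assoc (w * #accepted) _ _ ⟩
      w * #accepted + (w′ * #accepted + total es us)
        ≡⟨ cong (λ v → w * #accepted + (v + total es us)) (cong₂ (λ c k → w′ * length (accepted es k c)) c≡c′ k≡k′) ⟩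
      value es t + total es (u ∷ us)                      ∎

  collectAll : List Tally → List Tally
  collectAll []       = []
  collectAll (t ∷ ts) = collect t ts

  total-collectAll : ∀ {m} (es : Vec (Fin n × Fin n) m) ts → total es (collectAll ts) ≡ total es ts
  total-collectAll es []       = refl
  total-collectAll es (t ∷ ts) = total-collect es t ts

  -- Only efficiency depends on this key: it is injective for n < 64, so sorting by it makes
  -- tallies with the same state and the same number of remaining lines adjacent.
  key : Tally → ℕ
  key t = foldr (λ d k → d + 64 * k) (remaining t)
    (toList (Vec.map toℕ (labels (state t))) ++ toList (Vec.map b2n (cyclic (state t))))

  byKey : DecTotalOrder _ _ _
  byKey = On.decTotalOrder ℕ.≤-decTotalOrder (proj₁ {B = λ _ → Tally})

  -- Data.List.Sort would do, but it hides merge sort behind abstract, which blocks evaluation.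
  sortByKey : List Tally → List Tally
  sortByKey ts = map proj₂ (MergeSort.sort byKey (map (λ t → key t , t) ts))

  sortByKey-↭ : ∀ ts → sortByKey ts ↭ ts
  sortByKey-↭ ts = ↭-trans (Permutation.map⁺ proj₂ (MergeSort.sort-↭ byKey (map (λ t → key t , t) ts)))
                           (↭-reflexive (trans (sym (List.map-∘ ts)) (List.map-id ts)))

  normalize : List Tally → List Tally
  normalize ts = collectAll (sortByKey ts)

  total-normalize : ∀ {m} (es : Vec (Fin n × Fin n) m) ts → total es (normalize ts) ≡ total es ts
  total-normalize es ts =
    trans (total-collectAll es (sortByKey ts)) (sum-↭ (Permutation.map⁺ (value es) (sortByKey-↭ ts)))

  dp : ∀ {m} → Vec (Fin n × Fin n) m → List Tally → ℕ
  dp             []       ts = total [] ts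
  dp {m = suc m} (e ∷ es) ts = dp es (normalize (concatMap (advance e m) ts))

  dp-correct : ∀ {m} (es : Vec (Fin n × Fin n) m) ts → dp es ts ≡ total es ts
  dp-correct             []       ts = refl
  dp-correct {m = suc m} (e ∷ es) ts = begin
    dp es (normalize (concatMap (advance e m) ts))      ≡⟨ dp-correct es (normalize (concatMap (advance e m) ts)) ⟩
    total es (normalize (concatMap (advance e m) ts))   ≡⟨ total-normalize es (concatMap (advance e m) ts) ⟩
    total es (concatMap (advance e m) ts)               ≡⟨ total-advance e es ts ⟨
    total (e ∷ es) ts                                   ∎
    where open ≡-Reasoning

  dp-accepted : ∀ {m} (es : Vec (Fin n × Fin n) m) k c → dp es [ tally c k 1 ] ≡ length (accepted es k c)
  dp-accepted es k c =
    trans (dp-correct es [ tally c k 1 ]) (trans (total-[ es ] (tally c k 1)) (ℕ.*-identityˡ (length (accepted es k c))))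

-- Line tables

pairs : ℕ → ℕ
pairs zero    = 0
pairs (suc n) = n + pairs n

firstRowLines : ∀ n → Vec (Fin (suc n) × Fin (suc n)) n
firstRowLines n = tabulate (λ j → zero , suc j)

shift : ∀ {n} → Fin n × Fin n → Fin (suc n) × Fin (suc n)
shift = Product.map suc suc

lines : ∀ n → Vec (Fin n × Fin n) (pairs n)
lines zero    = []
lines (suc n) = firstRowLines n Vec.++ Vec.map shift (lines n)

toTable : ∀ n → Vec Bool (pairs n) → Vec (Vec Bool n) n
toTable zero    []  = []
toTable (suc n) bs = (false ∷ take n bs) ∷ Vec.map (false ∷_) (toTable n (drop n bs))

fromTable : ∀ {n} → Vec (Vec Bool n) n → Vec Bool (pairs n)
fromTable {zero}  []           = []
fromTable {suc n} (row ∷ rows) = tail row Vec.++ fromTable (Vec.map tail rows)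

UpperTriangular : ∀ {n} → Vec (Vec Bool n) n → Set
UpperTriangular M = ∀ i j → lookup (lookup M i) j ≡ true → i < j

lines-increasing : ∀ n → VecAll.All Increasing (lines n)
lines-increasing zero    = []
lines-increasing (suc n) =
  VecAll.++⁺ (VecAll.tabulate⁺ (λ _ → s≤s z≤n)) (VecAll.map⁺ (VecAll.map s≤s (lines-increasing n)))

shift-injective : ∀ {n} {l l′ : Fin n × Fin n} → shift l ≡ shift l′ → l ≡ l′
shift-injective {l = _ , _} {_ , _} refl = refl

lines-unique : ∀ n → VecUnique.Unique (lines n)
lines-unique zero    = []
lines-unique (suc n) =
  VecAllPairs.++⁺ (VecAllPairs.tabulate⁺ (λ i≢j → i≢j ∘ suc-injective ∘ cong proj₂))
                  (VecAllPairs.map⁺ (VecAllPairs.map (_∘ shift-injective) (lines-unique n)))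
                  (VecAll.tabulate⁺ (λ _ → VecAll.map⁺ (VecAll.universal (λ _ ()) (lines n))))

∈-chosen : ∀ {A : Set} {m} (xs : Vec A m) bs {x} →
           x ∈ chosen xs bs ⇔ ∃ λ i → lookup xs i ≡ x × lookup bs i ≡ true
∈-chosen []       []           = mk⇔ (λ ()) (λ ())
∈-chosen (y ∷ ys) (true ∷ bs)  = mk⇔ to from
  where
  to : _ ∈ chosen (y ∷ ys) (true ∷ bs) → _
  to (here refl) = zero , refl , refl
  to (there x∈)  = let i , yᵢ≡x , bᵢ = Equivalence.to (∈-chosen ys bs) x∈ in suc i , yᵢ≡x , bᵢ
  from : (∃ λ i → lookup (y ∷ ys) i ≡ _ × lookup (true ∷ bs) i ≡ true) → _ ∈ chosen (y ∷ ys) (true ∷ bs)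
  from (zero  , refl , _)  = here refl
  from (suc i , yᵢ≡x , bᵢ) = there (Equivalence.from (∈-chosen ys bs) (i , yᵢ≡x , bᵢ))
∈-chosen (y ∷ ys) (false ∷ bs) = mk⇔ to from
  where
  to : _ ∈ chosen (y ∷ ys) (false ∷ bs) → _
  to x∈ = let i , yᵢ≡x , bᵢ = Equivalence.to (∈-chosen ys bs) x∈ in suc i , yᵢ≡x , bᵢ
  from : (∃ λ i → lookup (y ∷ ys) i ≡ _ × lookup (false ∷ bs) i ≡ true) → _ ∈ chosen (y ∷ ys) (false ∷ bs)
  from (suc i , yᵢ≡x , bᵢ) = Equivalence.from (∈-chosen ys bs) (i , yᵢ≡x , bᵢ)

chosen-++ : ∀ {A : Set} {m k} (xs : Vec A m) (ys : Vec A k) bs →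
            chosen (xs Vec.++ ys) bs ≡ chosen xs (take m bs) ++ chosen ys (drop m bs)
chosen-++ []       ys bs           = refl
chosen-++ (x ∷ xs) ys (true ∷ bs)  = cong (x ∷_) (chosen-++ xs ys bs)
chosen-++ (x ∷ xs) ys (false ∷ bs) = chosen-++ xs ys bs

chosen-map : ∀ {A B : Set} {m} (f : A → B) (xs : Vec A m) bs → chosen (Vec.map f xs) bs ≡ map f (chosen xs bs)
chosen-map f []       []           = refl
chosen-map f (x ∷ xs) (true ∷ bs)  = cong (f x ∷_) (chosen-map f xs bs)
chosen-map f (x ∷ xs) (false ∷ bs) = chosen-map f xs bs

chosen-lines : ∀ n (bs : Vec Bool (pairs (suc n))) →
               chosen (lines (suc n)) bs ≡ chosen (firstRowLines n) (take n bs) ++ map shift (chosen (lines n) (drop n bs))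
chosen-lines n bs =
  trans (chosen-++ (firstRowLines n) _ bs)
        (cong (chosen (firstRowLines n) (take n bs) ++_) (chosen-map shift (lines n) (drop n bs)))

∈-firstRowLines : ∀ {n} (bs : Vec Bool n) {x} →
                  x ∈ chosen (firstRowLines n) bs ⇔ ∃ λ j → (zero , suc j) ≡ x × lookup bs j ≡ true
∈-firstRowLines {n} bs =
  ⇔.trans (∈-chosen (firstRowLines n) bs)
          (mk⇔ (Product.map₂ (Product.map₁ (trans (sym (tab _))))) (Product.map₂ (Product.map₁ (trans (tab _)))))
  where tab = lookup∘tabulate (λ j → zero {n} , suc j)

∈-++-left : ∀ {A : Set} (xs : List A) {ys x} → x ∉ ys → x ∈ xs ++ ys ⇔ x ∈ xs
∈-++-left xs x∉ys = mk⇔ (Sum.[ (λ x∈ → x∈) , ⊥-elim ∘ x∉ys ] ∘ ∈-++⁻ xs) ∈-++⁺ˡ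

∈-++-right : ∀ {A : Set} (xs : List A) {ys x} → x ∉ xs → x ∈ xs ++ ys ⇔ x ∈ ys
∈-++-right xs x∉xs = mk⇔ (Sum.[ ⊥-elim ∘ x∉xs , (λ x∈ → x∈) ] ∘ ∈-++⁻ xs) (∈-++⁺ʳ xs)

∈-map-shift : ∀ {n} (L : List (Fin n × Fin n)) {i j} → (suc i , suc j) ∈ map shift L ⇔ (i , j) ∈ L
∈-map-shift L = mk⇔ from (∈-map⁺ shift)
  where
  from : ∀ {i j} → (suc i , suc j) ∈ map shift L → (i , j) ∈ L
  from ij∈ with ∈-map⁻ shift ij∈
  ... | _ , l∈ , refl = l∈

entry-toTable : ∀ n (bs : Vec Bool (pairs n)) i j →
                lookup (lookup (toTable n bs) i) j ≡ true ⇔ (i , j) ∈ chosen (lines n) bs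
entry-toTable (suc n) bs i j =
  subst (λ L → lookup (lookup (toTable (suc n) bs) i) j ≡ true ⇔ (i , j) ∈ L) (sym (chosen-lines n bs)) (split i j)
  where
  firstRow lowerRows : List (Fin (suc n) × Fin (suc n))
  firstRow  = chosen (firstRowLines n) (take n bs)
  lowerRows = map shift (chosen (lines n) (drop n bs))
  lowerRow : ∀ i → lookup (toTable (suc n) bs) (suc i) ≡ false ∷ lookup (toTable n (drop n bs)) i
  lowerRow i = Vec.lookup-map i (false ∷_) (toTable n (drop n bs))
  zero∉lowerRows : ∀ {j} → (zero , j) ∉ lowerRows
  zero∉lowerRows 0j∈ with ∈-map⁻ shift 0j∈
  ... | _ , _ , ()
  zero∉lowerRowsʳ : ∀ {i} → (i , zero) ∉ lowerRows
  zero∉lowerRowsʳ i0∈ with ∈-map⁻ shift i0∈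
  ... | _ , _ , ()
  zero∉firstRow : ∀ {i} → (i , zero) ∉ firstRow
  zero∉firstRow i0∈ with () ← proj₁ (proj₂ (Equivalence.to (∈-firstRowLines (take n bs)) i0∈))
  suc∉firstRow : ∀ {i j} → (suc i , j) ∉ firstRow
  suc∉firstRow ij∈ with () ← proj₁ (proj₂ (Equivalence.to (∈-firstRowLines (take n bs)) ij∈))
  topEntry : ∀ {j} → lookup (take n bs) j ≡ true ⇔ (zero , suc j) ∈ firstRow
  topEntry {j} = ⇔.trans (mk⇔ (λ t → j , refl , t) (λ { (_ , refl , t) → t })) (⇔.sym (∈-firstRowLines (take n bs)))
  split : ∀ i j → lookup (lookup (toTable (suc n) bs) i) j ≡ true ⇔ (i , j) ∈ firstRow ++ lowerRows
  split zero    zero    = mk⇔ (λ ()) (⊥-elim ∘ zero∉firstRow ∘ Equivalence.to (∈-++-left firstRow zero∉lowerRows))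
  split zero    (suc j) = ⇔.trans topEntry (⇔.sym (∈-++-left firstRow zero∉lowerRows))
  split (suc i) zero    = mk⇔ noEntry (⊥-elim ∘ Sum.[ suc∉firstRow , zero∉lowerRowsʳ ] ∘ ∈-++⁻ firstRow)
    where
    noEntry : lookup (lookup (toTable (suc n) bs) (suc i)) zero ≡ true → (suc i , zero) ∈ firstRow ++ lowerRows
    noEntry e with () ← trans (sym (cong (λ row → lookup row zero) (lowerRow i))) e
  split (suc i) (suc j) =
    ⇔.trans (subst (λ e → e ≡ true ⇔ (i , j) ∈ chosen (lines n) (drop n bs)) (sym (cong (λ row → lookup row (suc j)) (lowerRow i)))
                   (entry-toTable n (drop n bs) i j))
            (⇔.trans (⇔.sym (∈-map-shift (chosen (lines n) (drop n bs)))) (⇔.sym (∈-++-right firstRow suc∉firstRow)))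

lookup-tail : ∀ {A : Set} {k} (v : Vec A (suc k)) j → lookup (tail v) j ≡ lookup v (suc j)
lookup-tail (_ ∷ _) _ = refl

fromTable-toTable : ∀ n (bs : Vec Bool (pairs n)) → fromTable (toTable n bs) ≡ bs
fromTable-toTable zero    []  = refl
fromTable-toTable (suc n) bs = begin
  take n bs Vec.++ fromTable (Vec.map tail (Vec.map (false ∷_) (toTable n (drop n bs))))
    ≡⟨ cong (λ rows → take n bs Vec.++ fromTable {n} rows) tail∘prepend ⟩
  take n bs Vec.++ fromTable (toTable n (drop n bs))
    ≡⟨ cong (take n bs Vec.++_) (fromTable-toTable n (drop n bs)) ⟩
  take n bs Vec.++ drop n bs
    ≡⟨ Vec.take++drop≡id n bs ⟩
  bs
    ∎
  where
  open ≡-Reasoning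
  tail∘prepend : Vec.map tail (Vec.map (false ∷_) (toTable n (drop n bs))) ≡ toTable n (drop n bs)
  tail∘prepend = trans (sym (Vec.map-∘ tail (false ∷_) (toTable n (drop n bs)))) (Vec.map-id (toTable n (drop n bs)))

toTable-fromTable : ∀ {n} (M : Vec (Vec Bool n) n) → UpperTriangular M → toTable n (fromTable M) ≡ M
toTable-fromTable {zero}  []                 _     = refl
toTable-fromTable {suc n} ((x ∷ r) ∷ rows) upper =
  cong₂ _∷_ (cong₂ _∷_ (offTrue x (below-zero ∘ upper zero zero)) take-r)
            (trans (cong (Vec.map (false ∷_)) (trans (cong (toTable n) drop-r) (toTable-fromTable (Vec.map tail rows) upper′)))
                   (restoreFirstColumn rows (λ i → below-zero ∘ upper (suc i) zero)))
  where
  F = fromTable (Vec.map tail rows)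
  take-r : take n (r Vec.++ F) ≡ r
  take-r = Vec.++-injectiveˡ (take n (r Vec.++ F)) r (Vec.take++drop≡id n (r Vec.++ F))
  drop-r : drop n (r Vec.++ F) ≡ F
  drop-r = Vec.++-injectiveʳ (take n (r Vec.++ F)) r (Vec.take++drop≡id n (r Vec.++ F))
  below-zero : ∀ {i : Fin (suc n)} → i < zero {n} → ⊥
  below-zero ()
  offTrue : ∀ b → (b ≡ true → ⊥) → false ≡ b
  offTrue false _     = refl
  offTrue true  ¬true with () ← ¬true refl
  upper′ : UpperTriangular (Vec.map tail rows)
  upper′ i j e
    with upper (suc i) (suc j) (trans (sym (trans (cong (λ row → lookup row j) (Vec.lookup-map i tail rows))
                                                  (lookup-tail (lookup rows i) j))) e)
  ... | s≤s i<j = i<j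
  restoreFirstColumn : ∀ {m} (rows : Vec (Vec Bool (suc n)) m) →
                       (∀ i → lookup (lookup rows i) zero ≡ true → ⊥) →
                       Vec.map (false ∷_) (Vec.map tail rows) ≡ rows
  restoreFirstColumn []                  _       = refl
  restoreFirstColumn ((y ∷ row) ∷ rows) ¬first =
    cong₂ _∷_ (cong (_∷ row) (offTrue y (¬first zero))) (restoreFirstColumn rows (¬first ∘ suc))

-- Definitionally equal to numLines on line tables.
lineCount : ∀ {k m} → Vec (Vec Bool k) m → ℕ
lineCount M = sum (map ones (toList M))

ones-++ : ∀ {k m} (u : Vec Bool k) (v : Vec Bool m) → ones (u Vec.++ v) ≡ ones u + ones v
ones-++ u v = begin
  sum (map b2n (toList (u Vec.++ v)))                            ≡⟨ cong (sum ∘ map b2n) (Vec.toList-++ u v) ⟩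
  sum (map b2n (toList u ++ toList v))                  ≡⟨ cong sum (List.map-++ b2n (toList u) (toList v)) ⟩
  sum (map b2n (toList u) ++ map b2n (toList v))   ≡⟨ sum-++ (map b2n (toList u)) _ ⟩
  ones u + ones v                                                 ∎
  where open ≡-Reasoning

lineCount-prepend-false : ∀ {k m} (M : Vec (Vec Bool k) m) → lineCount (Vec.map (false ∷_) M) ≡ lineCount M
lineCount-prepend-false []         = refl
lineCount-prepend-false (row ∷ M) = cong (ones row +_) (lineCount-prepend-false M)

lineCount-toTable : ∀ n (bs : Vec Bool (pairs n)) → lineCount (toTable n bs) ≡ ones bs
lineCount-toTable zero    []  = refl
lineCount-toTable (suc n) bs = begin
  ones (take n bs) + lineCount (Vec.map (false ∷_) (toTable n (drop n bs)))
    ≡⟨ cong (ones (take n bs) +_) (lineCount-prepend-false (toTable n (drop n bs))) ⟩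
  ones (take n bs) + lineCount (toTable n (drop n bs))  ≡⟨ cong (ones (take n bs) +_) (lineCount-toTable n (drop n bs)) ⟩
  ones (take n bs) + ones (drop n bs)                     ≡⟨ ones-++ (take n bs) (drop n bs) ⟨
  ones (take n bs Vec.++ drop n bs)                           ≡⟨ cong ones (Vec.take++drop≡id n bs) ⟩
  ones bs                                                 ∎
  where open ≡-Reasoning

chosen-increasing : ∀ n (bs : Vec Bool (pairs n)) {x y} → (x , y) ∈ chosen (lines n) bs → x < y
chosen-increasing n bs xy∈ with Equivalence.to (∈-chosen (lines n) bs) xy∈
... | i , eq , _ = subst Increasing eq (VecAll.lookup⁺ (lines-increasing n) i)

line⇔entry : ∀ n (bs : Vec Bool (pairs n)) {x y} →
             (x , y) ∈ chosen (lines n) bs ⇔ (x < y × lookup (lookup (toTable n bs) x) y ≡ true)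
line⇔entry n bs {x} {y} =
  mk⇔ (λ xy∈ → chosen-increasing n bs xy∈ , Equivalence.from (entry-toTable n bs x y) xy∈)
      (Equivalence.to (entry-toTable n bs x y) ∘ proj₂)

toTable-injective : ∀ n {bs bs′ : Vec Bool (pairs n)} → toTable n bs ≡ toTable n bs′ → bs ≡ bs′
toTable-injective n {bs} {bs′} eq =
  trans (sym (fromTable-toTable n bs)) (trans (cong fromTable eq) (fromTable-toTable n bs′))

-- Line complexes

module _ {M : LineTable} where

  reach⇔star : ∀ {x y} → Reach M x y ⇔ Star (Edge M) x y
  reach⇔star = mk⇔ to from
    where
    to : ∀ {x y} → Reach M x y → Star (Edge M) x y
    to Reach.here       = ε
    to (Reach.step e r) = e ◅ to r
    from : ∀ {x y} → Star (Edge M) x y → Reach M x y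
    from ε        = Reach.here
    from (e ◅ p)  = Reach.step e (from p)

  path⇔linked : ∀ xs → Path M xs ⇔ Linked (Edge M) xs
  path⇔linked xs = mk⇔ (to xs) (from xs)
    where
    to : ∀ xs → Path M xs → Linked (Edge M) xs
    to []           _        = []
    to (x ∷ [])     _        = [-]
    to (x ∷ y ∷ xs) (e , p) = e ∷ to (y ∷ xs) p
    from : ∀ xs → Linked (Edge M) xs → Path M xs
    from []           _        = tt
    from (x ∷ [])     _        = tt
    from (x ∷ y ∷ xs) (e ∷ p) = e , from (y ∷ xs) p

  isCycle⇔cycle : ∀ cs → IsCycle M cs ⇔ Cycle (Edge M) cs
  isCycle⇔cycle []       = mk⇔ (λ ()) (λ ())
  isCycle⇔cycle (v ∷ vs) = ⇔.refl ×-⇔ ⇔.refl ×-⇔ path⇔linked ((v ∷ vs) ∷ʳ v)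

  cycleInComponent⇔reachesCycle : ∀ {v} →
    (Σ (List Point) λ cs → IsCycle M cs × (∀ u → u ∈ cs → InComp M v u)) ⇔ ReachesCycle (Edge M) v
  cycleInComponent⇔reachesCycle = mk⇔ to from
    where
    to : ∀ {v} → (Σ (List Point) λ cs → IsCycle M cs × (∀ u → u ∈ cs → InComp M v u)) → ReachesCycle (Edge M) v
    to (w ∷ vs , cycle , inComp) =
      w , Equivalence.to reach⇔star (inComp w (here refl)) , vs , Equivalence.to (isCycle⇔cycle (w ∷ vs)) cycle
    from : ∀ {v} → ReachesCycle (Edge M) v → Σ (List Point) λ cs → IsCycle M cs × (∀ u → u ∈ cs → InComp M v u)
    from (w , v→w , vs , cycle) =
      w ∷ vs , Equivalence.from (isCycle⇔cycle (w ∷ vs)) cycle ,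
      λ u u∈ → Equivalence.from reach⇔star (v→w ◅◅ cycle⇒star vs cycle u∈)

  edge? : ∀ v w → Dec (Edge M v w)
  edge? v w = (v Fin.<? w ×-dec entry M v w Bool.≟ true) ⊎-dec (w Fin.<? v ×-dec entry M w v Bool.≟ true)

  good⇔cyclicComponents : (∀ v → Dec (ReachesCycle (Edge M) v)) →
                          Good M ⇔ (IsLineComplex M × ∀ v → ReachesCycle (Edge M) v)
  good⇔cyclicComponents reachesCycle? = mk⇔ to from
    where
    to : Good M → IsLineComplex M × ∀ v → ReachesCycle (Edge M) v
    to (complex , omitsNone , noTree) = complex , reaches
      where
      reaches : ∀ v → ReachesCycle (Edge M) v
      reaches v with reachesCycle? v | Fin.any? (edge? v)
      ... | yes rc | _            = rc
      ... | no _   | no noEdge    = ⊥-elim (omitsNone v (λ w e → noEdge (w , e)))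
      ... | no ¬rc | yes (w , e)  =
        ⊥-elim (noTree v ((v , w , Reach.here , Reach.step e Reach.here , e) ,
                          ¬rc ∘ Equivalence.to cycleInComponent⇔reachesCycle))
    from : IsLineComplex M × (∀ v → ReachesCycle (Edge M) v) → Good M
    from (complex , reaches) =
      complex ,
      (λ v omits → let w , e = reachesCycle⇒edge (reaches v) in omits w e) ,
      (λ v (_ , tree) → tree (Equivalence.from cycleInComponent⇔reachesCycle (reaches v)))

graph⇔edge : ∀ (bs : Vec Bool (pairs 8)) {x y} → graphOf (chosen (lines 8) bs ʳ++ []) x y ⇔ Edge (toTable 8 bs) x y
graph⇔edge bs =
  ⇔.trans (graphOf-∈ (chosen (lines 8) bs ʳ++ []))
          (line⇔ ⊎-⇔ line⇔)
  where
  line⇔ : ∀ {x y} → (x , y) ∈ (chosen (lines 8) bs ʳ++ []) ⇔ (x < y × entry (toTable 8 bs) x y ≡ true)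
  line⇔ = ⇔.trans (reverse-∈ (chosen (lines 8) bs)) (line⇔entry 8 bs)

table-tracks : ∀ (bs : Vec Bool (pairs 8)) → Tracks (Edge (toTable 8 bs)) (run (lines 8) bs discrete)
table-tracks bs =
  tracks-resp-⇔ (graph⇔edge bs)
    (run-tracks (lines 8) bs (lines-increasing 8) (lines-unique 8) (VecAll.universal (λ _ ()) (lines 8)) [] discrete-tracks)

good-toTable : ∀ (bs : Vec Bool (pairs 8)) → Good (toTable 8 bs) ⇔ (ones bs ≡ 8 × T (allCyclic (run (lines 8) bs discrete)))
good-toTable bs = ⇔.trans (good⇔cyclicComponents reachesCycle?) (mk⇔ to from)
  where
  c = run (lines 8) bs discrete
  open Tracks (table-tracks bs)
  reachesCycle? : ∀ v → Dec (ReachesCycle (Edge (toTable 8 bs)) v)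
  reachesCycle? v = map′ (Equivalence.to flag-T) (Equivalence.from flag-T) (T? (flag c v))
  upper : UpperTriangular (toTable 8 bs)
  upper i j = chosen-increasing 8 bs ∘ Equivalence.to (entry-toTable 8 bs i j)
  to : IsLineComplex (toTable 8 bs) × (∀ v → ReachesCycle (Edge (toTable 8 bs)) v) → ones bs ≡ 8 × T (allCyclic c)
  to ((_ , eight) , reaches) =
    trans (sym (lineCount-toTable 8 bs)) eight , Equivalence.from (T-allCyclic c) (Equivalence.from flag-T ∘ reaches)
  from : ones bs ≡ 8 × T (allCyclic c) → IsLineComplex (toTable 8 bs) × (∀ v → ReachesCycle (Edge (toTable 8 bs)) v)
  from (eight , cyclic) =
    (upper , trans (lineCount-toTable 8 bs) eight) , Equivalence.to flag-T ∘ Equivalence.to (T-allCyclic c) cyclic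

-- The list is kept abstract here and in hasExactly-map: comparing types that mention the
-- concrete list of accepted selections could make the type checker unfold it.
module _ (L : List (Vec Bool (pairs 8)))
         (∈L : ∀ bs → bs ∈ L ⇔ (ones bs ≡ 8 × T (allCyclic (run (lines 8) bs discrete)))) where

  good⇔∈tables : ∀ M → Good M ⇔ M ∈ map (toTable 8) L
  good⇔∈tables M = mk⇔ to from
    where
    to : Good M → M ∈ map (toTable 8) L
    to good@((upper , _) , _) =
      subst (_∈ map (toTable 8) L) M≡
        (∈-map⁺ (toTable 8) (Equivalence.from (∈L (fromTable M))
          (Equivalence.to (good-toTable (fromTable M)) (subst Good (sym M≡) good))))
      where
      M≡ : toTable 8 (fromTable M) ≡ M
      M≡ = toTable-fromTable M upper
    from : M ∈ map (toTable 8) L → Good M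
    from M∈ with ∈-map⁻ (toTable 8) M∈
    ... | bs , bs∈ , refl = Equivalence.from (good-toTable bs) (Equivalence.to (∈L bs) bs∈)

accepted-count : length (accepted (lines 8) 8 discrete) ≡ 1456875
accepted-count = trans (sym (dp-accepted (lines 8) 8 discrete)) dp-value
  where
  dp-value : dp (lines 8) [ tally discrete 8 1 ] ≡ 1456875
  dp-value = refl

hasExactly-map : ∀ {A B : Set} {Q : B → Set} (f : A → B) → (∀ {x y} → f x ≡ f y → x ≡ y) →
                 ∀ xs → Unique xs → (∀ b → Q b ⇔ b ∈ map f xs) → HasExactly Q (length xs)
hasExactly-map f f-injective xs unique members =
  map f xs , List.length-map f xs , Unique.map⁺ f-injective unique , members

mainTheorem11 : HasExactly Good 1456875
mainTheorem11 =
  subst (HasExactly Good) accepted-count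
    (hasExactly-map (toTable 8) (toTable-injective 8)
       (accepted (lines 8) 8 discrete) (accepted-unique (lines 8) 8 discrete)
       (good⇔∈tables (accepted (lines 8) 8 discrete) (∈-accepted (lines 8) {8} {discrete})))
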